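{- In the variety of Brignole algebras, each of the axioms (B1), (B3), (B5), (B6) and (B9) is independent of the remaining axioms; that is, for each of these axioms there is an algebra $\langle A,\land_B,\rightarrowtail,0\rangle$ of type $(2,2,0)$ satisfying all the other axioms among (B1)–(B10) but not that one.
   Context: For an algebra $\langle A,\land_B,\rightarrowtail,0\rangle$ of type $(2,2,0)$ put $\sim_B x:=x\rightarrowtail 0$ and $x\lor_B y:=((x\rightarrowtail 0)\land_B(y\rightarrowtail 0))\rightarrowtail 0$. The axioms are, for all $x,y,z$: (B1) $(x\rightarrowtail x)\rightarrowtail y=y$; (B2) $(x\rightarrowtail y)\land_B y=y$; (B3) $x\land_B\sim_B(x\land_B\sim_B y)=x\land_B(x\rightarrowtail y)$; (B4) $x\rightarrowtail(y\land_B z)=(x\rightarrowtail y)\land_B(x\rightarrowtail z)$; (B5) $x\rightarrowtail y=\sim_B y\rightarrowtail\sim_B x$; (B6) $x\rightarrowtail(x\rightarrowtail(y\rightarrowtail(y\rightarrowtail z)))=(x\land_B y)\rightarrowtail((x\land_B y)\rightarrowtail z)$; (B7) $\sim_B(\sim_B x\land_B y)\rightarrowtail(x\rightarrowtail y)=x\rightarrowtail y$; (B8) $x\land_B(x\lor_B y)=x$; (B9) $x\land_B(y\lor_B z)=(z\land_B x)\lor_B(y\land_B x)$; (B10) $(x\land_B\sim_B x)\land_B(y\lor_B\sim_B y)=x\land_B\sim_B x$. A Brignole algebra is an algebra satisfying (B1)–(B10). -}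

module Defs where

open import Data.Fin using (Fin; zero; suc)
open import Data.Product using (Σ; _×_; _,_)
open import Relation.Binary.PropositionalEquality using (_≡_)
open import Relation.Nullary using (¬_)

record Alg : Set₁ where
  field
    Carrier : Set
    _∧_     : Carrier → Carrier → Carrier
    _↣_     : Carrier → Carrier → Carrier
    𝟎       : Carrier

  infixr 5 _↣_
  infixl 6 _∧_

  ∼_ : Carrier → Carrier
  ∼ x = x ↣ 𝟎

  _∨_ : Carrier → Carrier → Carrier
  x ∨ y = ((x ↣ 𝟎) ∧ (y ↣ 𝟎)) ↣ 𝟎

module _ (𝔸 : Alg) where
  open Alg 𝔸

  B1 : Set
  B1 = ∀ x y → (x ↣ x) ↣ y ≡ y

  B2 : Set
  B2 = ∀ x y → (x ↣ y) ∧ y ≡ y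

  B3 : Set
  B3 = ∀ x y → x ∧ (∼ (x ∧ (∼ y))) ≡ x ∧ (x ↣ y)

  B4 : Set
  B4 = ∀ x y z → x ↣ (y ∧ z) ≡ (x ↣ y) ∧ (x ↣ z)

  B5 : Set
  B5 = ∀ x y → x ↣ y ≡ (∼ y) ↣ (∼ x)

  B6 : Set
  B6 = ∀ x y z → x ↣ (x ↣ (y ↣ (y ↣ z))) ≡ (x ∧ y) ↣ ((x ∧ y) ↣ z)

  B7 : Set
  B7 = ∀ x y → (∼ ((∼ x) ∧ y)) ↣ (x ↣ y) ≡ x ↣ y

  B8 : Set
  B8 = ∀ x y → x ∧ (x ∨ y) ≡ x

  B9 : Set
  B9 = ∀ x y z → x ∧ (y ∨ z) ≡ (z ∧ x) ∨ (y ∧ x)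

  B10 : Set
  B10 = ∀ x y → (x ∧ (∼ x)) ∧ (y ∨ (∼ y)) ≡ x ∧ (∼ x)

  Axiom : Fin 10 → Set
  Axiom zero = B1
  Axiom (suc zero) = B2
  Axiom (suc (suc zero)) = B3
  Axiom (suc (suc (suc zero))) = B4
  Axiom (suc (suc (suc (suc zero)))) = B5
  Axiom (suc (suc (suc (suc (suc zero))))) = B6
  Axiom (suc (suc (suc (suc (suc (suc zero)))))) = B7
  Axiom (suc (suc (suc (suc (suc (suc (suc zero))))))) = B8
  Axiom (suc (suc (suc (suc (suc (suc (suc (suc zero)))))))) = B9
  Axiom (suc (suc (suc (suc (suc (suc (suc (suc (suc zero))))))))) = B10

Independent : Fin 10 → Set₁
Independent i = Σ Alg λ 𝔸 → ((j : Fin 10) → ¬ (j ≡ i) → Axiom 𝔸 j) × ¬ Axiom 𝔸 i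

iB1 iB3 iB5 iB6 iB9 : Fin 10
iB1 = zero
iB3 = suc (suc zero)
iB5 = suc (suc (suc (suc zero)))
iB6 = suc (suc (suc (suc (suc zero))))
iB9 = suc (suc (suc (suc (suc (suc (suc (suc zero)))))))

-- Each independence is witnessed by a finite algebra on {0,…,n-1}, with 0 as the
-- constant, in which the chosen axiom fails at explicitly given elements. Over a
-- finite carrier with decidable equality the axioms, being universally quantified
-- equations, are decidable, so the remaining nine are verified by evaluation.
module Submission where

open import Defs
open import Data.Fin using (Fin; zero; suc; _≟_)
open import Data.Fin.Properties using (all?)
import Data.Fin.Literals as FinLiterals
import Data.Nat.Literals as NatLiterals
open import Data.Nat using (ℕ)
open import Data.Unit using (⊤; tt)
open import Data.Product using (_×_; _,_)
open import Data.Vec using (Vec; []; _∷_; lookup)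
open import Agda.Builtin.FromNat using (Number; fromNat)
open import Relation.Binary.PropositionalEquality using (_≡_)
open import Relation.Nullary using (¬_; Dec; ¬?; _→-dec_)
open import Relation.Nullary.Decidable using (True; toWitness)

-- Numeric literals (with fromNat in scope) for ℕ and for Fin n, whose bound
-- check is a ⊤ instance constraint.
instance
  ⊤-instance : ⊤
  ⊤-instance = tt

  natNumber : Number ℕ
  natNumber = NatLiterals.number

  finNumber : {n : ℕ} → Number (Fin n)
  finNumber {n} = FinLiterals.number n

Table : ℕ → Set
Table n = Vec (Vec (Fin n) n) n

tableAlg : {n : ℕ} → Table n → Table n → Fin n → Alg
tableAlg {n} meet imp 𝟎 = record
  { Carrier = Fin n
  ; _∧_     = λ x y → lookup (lookup meet x) y
  ; _↣_     = λ x y → lookup (lookup imp x) y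
  ; 𝟎       = 𝟎
  }

module _ {n : ℕ} where

  ∀₂? : {P : Fin n → Fin n → Set} → (∀ x y → Dec (P x y)) → Dec (∀ x y → P x y)
  ∀₂? P? = all? λ x → all? (P? x)

  ∀₃? : {P : Fin n → Fin n → Fin n → Set} →
        (∀ x y z → Dec (P x y z)) → Dec (∀ x y z → P x y z)
  ∀₃? P? = all? λ x → ∀₂? (P? x)

  module _ (meet imp : Table n) (𝟎 : Fin n) where

    private
      𝔸 : Alg
      𝔸 = tableAlg meet imp 𝟎

    axiom? : ∀ i → Dec (Axiom 𝔸 i)
    axiom? zero = ∀₂? λ _ _ → _ ≟ _
    axiom? (suc zero) = ∀₂? λ _ _ → _ ≟ _
    axiom? (suc (suc zero)) = ∀₂? λ _ _ → _ ≟ _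
    axiom? (suc (suc (suc zero))) = ∀₃? λ _ _ _ → _ ≟ _
    axiom? (suc (suc (suc (suc zero)))) = ∀₂? λ _ _ → _ ≟ _
    axiom? (suc (suc (suc (suc (suc zero))))) = ∀₃? λ _ _ _ → _ ≟ _
    axiom? (suc (suc (suc (suc (suc (suc zero)))))) = ∀₂? λ _ _ → _ ≟ _
    axiom? (suc (suc (suc (suc (suc (suc (suc zero))))))) = ∀₂? λ _ _ → _ ≟ _
    axiom? (suc (suc (suc (suc (suc (suc (suc (suc zero)))))))) = ∀₃? λ _ _ _ → _ ≟ _
    axiom? (suc (suc (suc (suc (suc (suc (suc (suc (suc zero))))))))) = ∀₂? λ _ _ → _ ≟ _

    otherAxioms? : ∀ i → Dec (∀ j → ¬ j ≡ i → Axiom 𝔸 j)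
    otherAxioms? i = all? λ j → ¬? (j ≟ i) →-dec axiom? j

    independent-by-table : ∀ i → True (otherAxioms? i) → ¬ Axiom 𝔸 i → Independent i
    independent-by-table i others ¬axiom = 𝔸 , toWitness others , ¬axiom

module ModelB1 where

  meet imp : Table 3
  meet = (0 ∷ 0 ∷ 0 ∷ [])
       ∷ (0 ∷ 1 ∷ 1 ∷ [])
       ∷ (0 ∷ 1 ∷ 2 ∷ [])
       ∷ []
  imp  = (2 ∷ 2 ∷ 2 ∷ [])
       ∷ (1 ∷ 1 ∷ 2 ∷ [])
       ∷ (0 ∷ 1 ∷ 2 ∷ [])
       ∷ []

  ¬B1 : ¬ B1 (tableAlg meet imp 0)
  ¬B1 b1 with b1 1 0
  ... | ()

  independent : Independent iB1
  independent = independent-by-table meet imp 0 iB1 _ ¬B1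

module ModelB3 where

  meet imp : Table 4
  meet = (0 ∷ 0 ∷ 0 ∷ 0 ∷ [])
       ∷ (0 ∷ 1 ∷ 2 ∷ 3 ∷ [])
       ∷ (0 ∷ 2 ∷ 2 ∷ 2 ∷ [])
       ∷ (0 ∷ 3 ∷ 2 ∷ 3 ∷ [])
       ∷ []
  imp  = (1 ∷ 1 ∷ 1 ∷ 1 ∷ [])
       ∷ (0 ∷ 1 ∷ 2 ∷ 3 ∷ [])
       ∷ (3 ∷ 1 ∷ 1 ∷ 1 ∷ [])
       ∷ (2 ∷ 1 ∷ 1 ∷ 1 ∷ [])
       ∷ []

  ¬B3 : ¬ B3 (tableAlg meet imp 0)
  ¬B3 b3 with b3 3 2
  ... | ()

  independent : Independent iB3
  independent = independent-by-table meet imp 0 iB3 _ ¬B3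

module ModelB5 where

  meet imp : Table 5
  meet = (0 ∷ 0 ∷ 0 ∷ 0 ∷ 0 ∷ [])
       ∷ (0 ∷ 1 ∷ 2 ∷ 3 ∷ 4 ∷ [])
       ∷ (0 ∷ 2 ∷ 2 ∷ 3 ∷ 2 ∷ [])
       ∷ (0 ∷ 3 ∷ 3 ∷ 3 ∷ 3 ∷ [])
       ∷ (0 ∷ 4 ∷ 2 ∷ 3 ∷ 4 ∷ [])
       ∷ []
  imp  = (1 ∷ 1 ∷ 1 ∷ 1 ∷ 1 ∷ [])
       ∷ (0 ∷ 1 ∷ 2 ∷ 3 ∷ 4 ∷ [])
       ∷ (2 ∷ 1 ∷ 1 ∷ 1 ∷ 1 ∷ [])
       ∷ (4 ∷ 1 ∷ 1 ∷ 1 ∷ 1 ∷ [])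
       ∷ (3 ∷ 1 ∷ 2 ∷ 3 ∷ 1 ∷ [])
       ∷ []

  ¬B5 : ¬ B5 (tableAlg meet imp 0)
  ¬B5 b5 with b5 2 3
  ... | ()

  independent : Independent iB5
  independent = independent-by-table meet imp 0 iB5 _ ¬B5

module ModelB6 where

  meet imp : Table 7
  meet = (0 ∷ 0 ∷ 0 ∷ 0 ∷ 0 ∷ 0 ∷ 0 ∷ [])
       ∷ (0 ∷ 1 ∷ 2 ∷ 3 ∷ 4 ∷ 5 ∷ 6 ∷ [])
       ∷ (0 ∷ 2 ∷ 2 ∷ 3 ∷ 2 ∷ 5 ∷ 2 ∷ [])
       ∷ (0 ∷ 3 ∷ 3 ∷ 3 ∷ 3 ∷ 0 ∷ 3 ∷ [])
       ∷ (0 ∷ 4 ∷ 2 ∷ 3 ∷ 4 ∷ 5 ∷ 2 ∷ [])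
       ∷ (0 ∷ 5 ∷ 5 ∷ 0 ∷ 5 ∷ 5 ∷ 5 ∷ [])
       ∷ (0 ∷ 6 ∷ 2 ∷ 3 ∷ 2 ∷ 5 ∷ 6 ∷ [])
       ∷ []
  imp  = (1 ∷ 1 ∷ 1 ∷ 1 ∷ 1 ∷ 1 ∷ 1 ∷ [])
       ∷ (0 ∷ 1 ∷ 2 ∷ 3 ∷ 4 ∷ 5 ∷ 6 ∷ [])
       ∷ (2 ∷ 1 ∷ 1 ∷ 6 ∷ 1 ∷ 4 ∷ 1 ∷ [])
       ∷ (4 ∷ 1 ∷ 1 ∷ 1 ∷ 1 ∷ 4 ∷ 1 ∷ [])
       ∷ (3 ∷ 1 ∷ 6 ∷ 3 ∷ 1 ∷ 2 ∷ 6 ∷ [])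
       ∷ (6 ∷ 1 ∷ 1 ∷ 6 ∷ 1 ∷ 1 ∷ 1 ∷ [])
       ∷ (5 ∷ 1 ∷ 4 ∷ 2 ∷ 4 ∷ 5 ∷ 1 ∷ [])
       ∷ []

  ¬B6 : ¬ B6 (tableAlg meet imp 0)
  ¬B6 b6 with b6 4 6 0
  ... | ()

  independent : Independent iB6
  independent = independent-by-table meet imp 0 iB6 _ ¬B6

module ModelB9 where

  meet imp : Table 4
  meet = (0 ∷ 0 ∷ 0 ∷ 0 ∷ [])
       ∷ (0 ∷ 1 ∷ 2 ∷ 3 ∷ [])
       ∷ (0 ∷ 2 ∷ 2 ∷ 2 ∷ [])
       ∷ (0 ∷ 3 ∷ 3 ∷ 3 ∷ [])
       ∷ []
  imp  = (1 ∷ 1 ∷ 1 ∷ 1 ∷ [])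
       ∷ (0 ∷ 1 ∷ 2 ∷ 3 ∷ [])
       ∷ (2 ∷ 1 ∷ 1 ∷ 1 ∷ [])
       ∷ (3 ∷ 1 ∷ 1 ∷ 1 ∷ [])
       ∷ []

  ¬B9 : ¬ B9 (tableAlg meet imp 0)
  ¬B9 b9 with b9 1 2 3
  ... | ()

  independent : Independent iB9
  independent = independent-by-table meet imp 0 iB9 _ ¬B9

mainTheorem3 : Independent iB1 × Independent iB3 × Independent iB5 × Independent iB6 × Independent iB9
mainTheorem3 =
  ModelB1.independent , ModelB3.independent , ModelB5.independent ,
  ModelB6.independent , ModelB9.independent
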